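{- If $\Gamma$ is a cubic girth-regular graph with signature $(a,b,c)$ and odd girth $g$, then $a\ne 1$.
   Context: Graphs are finite and simple; cubic means $3$-regular. For a graph of finite girth $g$, a girth cycle is a cycle of length $g$, and $\epsilon(e)$ is the number of girth cycles containing the edge $e$. The signature of a vertex $v$ with incident edges $e_1,\ldots,e_k$ ordered so that $\epsilon(e_1)\le\cdots\le\epsilon(e_k)$ is $(\epsilon(e_1),\ldots,\epsilon(e_k))$; a graph is girth-regular if all vertices have the same signature (the signature of the graph). -}

module Defs where

open import Data.Nat using (ℕ; zero; suc; _≤_; _<_; _∸_)
open import Data.Nat.Properties using ()
open import Data.Fin using (Fin; toℕ)
open import Data.Bool using (Bool; true)
open import Data.Vec using (Vec; lookup)
open import Data.List using (List; length)
open import Data.List.Membership.Propositional using (_∈_)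
open import Data.List.Relation.Unary.Unique.Propositional using (Unique)
open import Data.Product using (Σ; ∃; ∃-syntax; _×_; _,_)
open import Data.Sum using (_⊎_)
open import Relation.Nullary using (¬_)
open import Relation.Binary.PropositionalEquality using (_≡_; _≢_)
open import Function.Definitions using (Injective)
open import Function.Bundles using (_⇔_)

record Graph (n : ℕ) : Set₁ where
  field
    _~_    : Fin n → Fin n → Set
    sym    : ∀ {u v} → u ~ v → v ~ u
    irrefl : ∀ {u} → ¬ (u ~ u)
open Graph public

Cubic : ∀ {n} → Graph n → Set
Cubic {n} G = ∀ v → Σ (Fin n) λ x → Σ (Fin n) λ y → Σ (Fin n) λ z →
  (_~_ G v x × _~_ G v y × _~_ G v z) ×
  (x ≢ y × x ≢ z × y ≢ z) ×
  (∀ w → _~_ G v w → (w ≡ x ⊎ w ≡ y ⊎ w ≡ z))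

Consec : (k : ℕ) → Fin k → Fin k → Set
Consec k i j = toℕ j ≡ suc (toℕ i) ⊎ (toℕ i ≡ k ∸ 1 × toℕ j ≡ 0)

IsCycleSeq : ∀ {n} → Graph n → (k : ℕ) → (Fin k → Fin n) → Set
IsCycleSeq G k f = (3 ≤ k) × Injective _≡_ _≡_ f ×
  (∀ i j → Consec k i j → _~_ G (f i) (f j))

-- Edge sets (subgraphs) are represented by symmetric 0/1 adjacency matrices.
EdgeSet : ℕ → Set
EdgeSet n = Vec (Vec Bool n) n

_∋ₑ_,_ : ∀ {n} → EdgeSet n → Fin n → Fin n → Set
C ∋ₑ u , v = lookup (lookup C u) v ≡ true

EdgeSetOf : ∀ {n} (k : ℕ) → (Fin k → Fin n) → EdgeSet n → Set
EdgeSetOf {n} k f C = ∀ (u v : Fin n) →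
  (C ∋ₑ u , v) ⇔ (∃[ i ] ∃[ j ] (Consec k i j ×
                   ((f i ≡ u × f j ≡ v) ⊎ (f i ≡ v × f j ≡ u))))

IsCycle : ∀ {n} → Graph n → ℕ → EdgeSet n → Set
IsCycle {n} G k C = Σ (Fin k → Fin n) λ f → IsCycleSeq G k f × EdgeSetOf k f C

Girth : ∀ {n} → Graph n → ℕ → Set
Girth {n} G g = (Σ (EdgeSet n) λ C → IsCycle G g C) ×
  (∀ k → k < g → ∀ (C : EdgeSet n) → ¬ IsCycle G k C)

-- ε(uv) = m : exactly m girth cycles (as subgraphs) contain the edge uv.
-- (Expressed as: there is a duplicate-free list of exactly the girth
-- cycles containing uv, and it has length m.)
Epsilon : ∀ {n} → Graph n → (g : ℕ) → Fin n → Fin n → ℕ → Set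
Epsilon {n} G g u v m = Σ (List (EdgeSet n)) λ L →
  Unique L × length L ≡ m ×
  (∀ C → (C ∈ L) ⇔ (IsCycle G g C × (C ∋ₑ u , v)))

GirthRegular : ∀ {n} → Graph n → (g : ℕ) → ℕ → ℕ → ℕ → Set
GirthRegular {n} G g a b c = (a ≤ b × b ≤ c) × (∀ v →
  Σ (Fin n) λ x → Σ (Fin n) λ y → Σ (Fin n) λ z →
  (_~_ G v x × _~_ G v y × _~_ G v z) ×
  (x ≢ y × x ≢ z × y ≢ z) ×
  (∀ w → _~_ G v w → (w ≡ x ⊎ w ≡ y ⊎ w ≡ z)) ×
  (Epsilon G g v x a × Epsilon G g v y b × Epsilon G g v z c))

module Submission where

-- At every vertex v with neighbours x, y, z (where ε(vx) = 1, ε(vy) = b,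
-- ε(vz) = c) the unique girth cycle through vx, together with the count
-- comparison of duplicate-free lists of cycles, shows:
--   * no girth cycle passes through both vx and vy, hence
--   * b < c, so the edge vz is recognised from both of its ends: the map
--     Z : v ↦ z is an involution, i.e. the edges vZ(v) form a perfect matching;
--   * every girth cycle through v uses the matching edge vZ(v).
-- Walking along a girth cycle the matching edges therefore alternate with the
-- other edges, which is impossible on a cycle of odd length.

open import Defs hiding (sym)
open import Data.Nat using (ℕ; zero; suc; _≤_; _<_; _+_; _*_; _/_; _%_; s≤s; s≤s⁻¹)
open import Data.Nat.Properties
  using (suc-injective; ≤-trans; ≤-reflexive; ≤-antisym; <-irrefl; <-asym; ≤⇒≯; ≰⇒>; n≤1+n; n<1+n; _<?_)
open import Data.Nat.DivMod using (m≡m%n+[m/n]*n)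
open import Data.Nat.GeneralisedArithmetic using (fold)
open import Data.Fin using (Fin; toℕ; fromℕ; fromℕ<; inject₁) renaming (zero to fzero; suc to fsuc)
open import Data.Fin.Properties using (toℕ-injective; toℕ-fromℕ; toℕ-fromℕ<; toℕ-inject₁; toℕ<n)
open import Data.List using (List; []; _∷_; length)
open import Data.List.Membership.Propositional using (_∈_; _∉_)
open import Data.List.Relation.Unary.Any using (here; there)
open import Data.List.Relation.Unary.Unique.Propositional using (Unique)
open import Data.List.Relation.Unary.AllPairs using ([]; _∷_)
import Data.List.Fresh as Fresh
import Data.List.Fresh.Relation.Unary.Any as FreshAny
import Data.List.Fresh.Membership.Setoid as FreshMembership
import Data.List.Fresh.Membership.Setoid.Properties as FreshMembershipProperties
open import Data.Product using (Σ; _×_; _,_; proj₁; proj₂)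
open import Data.Sum using (_⊎_; inj₁; inj₂; swap)
open import Data.Empty using (⊥; ⊥-elim)
open import Relation.Nullary using (¬_; yes; no)
open import Relation.Binary.PropositionalEquality
  using (_≡_; _≢_; refl; sym; trans; cong; subst; subst₂; setoid; module ≡-Reasoning)
open import Function.Bundles using (Equivalence)

module _ {A : Set} where
  open FreshMembership (setoid A) using () renaming (_∈_ to _∈#_)
  open FreshMembershipProperties (setoid A) using (injection; strict-injection)

  private
    length-fromList : ∀ {xs : List A} (u : Unique xs) → Fresh.length (Fresh.fromList u) ≡ length xs
    length-fromList []      = refl
    length-fromList (_ ∷ u) = cong suc (length-fromList u)

    ∈⇒∈# : ∀ {x} {xs : List A} (u : Unique xs) → x ∈ xs → x ∈# Fresh.fromList u
    ∈⇒∈# (_ ∷ u) (here x≡y)  = FreshAny.here x≡y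
    ∈⇒∈# (_ ∷ u) (there x∈) = FreshAny.there (∈⇒∈# u x∈)

    ∈#⇒∈ : ∀ {x} {xs : List A} (u : Unique xs) → x ∈# Fresh.fromList u → x ∈ xs
    ∈#⇒∈ (_ ∷ u) (FreshAny.here x≡y)  = here x≡y
    ∈#⇒∈ (_ ∷ u) (FreshAny.there x∈) = there (∈#⇒∈ u x∈)

  unique-⊆⇒≤ : ∀ {xs ys : List A} → Unique xs → Unique ys →
               (∀ {x} → x ∈ xs → x ∈ ys) → length xs ≤ length ys
  unique-⊆⇒≤ uxs uys xs⊆ys =
    subst₂ _≤_ (length-fromList uxs) (length-fromList uys)
      (injection (λ x≢y → x≢y) (λ x∈ → ∈⇒∈# uys (xs⊆ys (∈#⇒∈ uxs x∈))))

  unique-⊂⇒< : ∀ {xs ys : List A} {y} → Unique xs → Unique ys →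
               (∀ {x} → x ∈ xs → x ∈ ys) → y ∈ ys → y ∉ xs → length xs < length ys
  unique-⊂⇒< uxs uys xs⊆ys y∈ys y∉xs =
    subst₂ _<_ (length-fromList uxs) (length-fromList uys)
      (strict-injection (λ x≢y → x≢y) (λ x∈ → ∈⇒∈# uys (xs⊆ys (∈#⇒∈ uxs x∈)))
        (_ , ∈⇒∈# uys y∈ys , λ y∈ → y∉xs (∈#⇒∈ uxs y∈)))

consec-asym : ∀ {k} {i j : Fin k} → 3 ≤ k → Consec k i j → Consec k j i → ⊥
consec-asym {k} {i} {j} (s≤s (s≤s (s≤s _))) = cases
  where
  2+m≢1 : ∀ {m} → suc (suc m) ≢ 1
  2+m≢1 ()

  0≢2+m : ∀ {m} → 0 ≢ suc (suc m)
  0≢2+m ()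

  cases : Consec k i j → Consec k j i → ⊥
  cases (inj₁ j≡1+i) (inj₁ i≡1+j) =
    <-asym (≤-reflexive (sym j≡1+i)) (≤-reflexive (sym i≡1+j))
  cases (inj₁ j≡1+i) (inj₂ (j≡last , i≡0)) =
    2+m≢1 (trans (sym j≡last) (trans j≡1+i (cong suc i≡0)))
  cases (inj₂ (i≡last , j≡0)) (inj₁ i≡1+j) =
    2+m≢1 (trans (sym i≡last) (trans i≡1+j (cong suc j≡0)))
  cases (inj₂ (i≡last , _)) (inj₂ (_ , i≡0)) = 0≢2+m (trans (sym i≡0) i≡last)

consec-functional : ∀ {k} {i j j′ : Fin k} → Consec k i j → Consec k i j′ → j ≡ j′
consec-functional {zero} {()}
consec-functional {suc k} {i} {j} {j′} = cases
  where
  cases : Consec (suc k) i j → Consec (suc k) i j′ → j ≡ j′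
  cases (inj₁ j≡1+i) (inj₁ j′≡1+i) = toℕ-injective (trans j≡1+i (sym j′≡1+i))
  cases (inj₂ (_ , j≡0)) (inj₂ (_ , j′≡0)) = toℕ-injective (trans j≡0 (sym j′≡0))
  cases (inj₁ j≡1+i) (inj₂ (i≡last , _)) =
    ⊥-elim (<-irrefl (trans j≡1+i (cong suc i≡last)) (toℕ<n j))
  cases (inj₂ (i≡last , _)) (inj₁ j′≡1+i) =
    ⊥-elim (<-irrefl (trans j′≡1+i (cong suc i≡last)) (toℕ<n j′))

consec-injective : ∀ {k} {i i′ j : Fin k} → Consec k i j → Consec k i′ j → i ≡ i′
consec-injective {k} {i} {i′} {j} = cases
  where
  1+m≢0 : ∀ {m} → suc m ≢ 0
  1+m≢0 ()

  cases : Consec k i j → Consec k i′ j → i ≡ i′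
  cases (inj₁ j≡1+i) (inj₁ j≡1+i′) = toℕ-injective (suc-injective (trans (sym j≡1+i) j≡1+i′))
  cases (inj₂ (i≡last , _)) (inj₂ (i′≡last , _)) = toℕ-injective (trans i≡last (sym i′≡last))
  cases (inj₁ j≡1+i) (inj₂ (_ , j≡0)) = ⊥-elim (1+m≢0 (trans (sym j≡1+i) j≡0))
  cases (inj₂ (_ , j≡0)) (inj₁ j≡1+i′) = ⊥-elim (1+m≢0 (trans (sym j≡1+i′) j≡0))

successor : ∀ {k} (i : Fin k) → Σ (Fin k) λ j → Consec k i j
successor {suc k′} i with suc (toℕ i) <? suc k′
... | yes i+1<k = fromℕ< i+1<k , inj₁ (toℕ-fromℕ< i+1<k)
... | no  i+1≮k = fzero , inj₂ (≤-antisym (s≤s⁻¹ (toℕ<n i)) (s≤s⁻¹ (s≤s⁻¹ (≰⇒> i+1≮k))) , refl)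

predecessor : ∀ {k} (j : Fin k) → Σ (Fin k) λ i → Consec k i j
predecessor {suc k′} fzero    = fromℕ k′ , inj₂ (toℕ-fromℕ k′ , refl)
predecessor {suc k′} (fsuc j) = inject₁ j , inj₁ (cong suc (sym (toℕ-inject₁ j)))

succ pred : ∀ {k} → Fin k → Fin k
succ i = proj₁ (successor i)
pred j = proj₁ (predecessor j)

succ-consec : ∀ {k} (i : Fin k) → Consec k i (succ i)
succ-consec i = proj₂ (successor i)

pred-consec : ∀ {k} (j : Fin k) → Consec k (pred j) j
pred-consec j = proj₂ (predecessor j)

pred-succ : ∀ {k} (i : Fin k) → pred (succ i) ≡ i
pred-succ i = consec-injective (pred-consec (succ i)) (succ-consec i)

walk-position : ∀ {k} m → m < suc k → toℕ (fold (fzero {k}) succ m) ≡ m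
walk-position zero _ = refl
walk-position {k} (suc m) m+1<k = step (succ-consec w)
  where
  w : Fin (suc k)
  w = fold fzero succ m

  at-m : toℕ w ≡ m
  at-m = walk-position m (≤-trans (n≤1+n (suc m)) m+1<k)

  step : Consec (suc k) w (succ w) → toℕ (succ w) ≡ suc m
  step (inj₁ next≡1+m)     = trans next≡1+m (cong suc at-m)
  step (inj₂ (m≡last , _)) = ⊥-elim (<-irrefl (trans (sym at-m) m≡last) (s≤s⁻¹ m+1<k))

walk-period : ∀ k → fold (fzero {k}) succ (suc k) ≡ fzero
walk-period k with succ-consec (fold (fzero {k}) succ k)
... | inj₁ next≡1+k = ⊥-elim (<-irrefl (trans next≡1+k (cong suc (walk-position k (n<1+n k)))) (toℕ<n _))
... | inj₂ (_ , next≡0) = toℕ-injective next≡0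

-- A predicate that flips at every step of a walk (true is followed by false and
-- false by true) is preserved by two steps, so the walk cannot be periodic with
-- odd period.
module _ {X : Set} (σ : X → X) (E : X → Set)
         (true⇒false : ∀ x → E x → ¬ E (σ x)) (false⇒true : ∀ x → ¬ E x → E (σ x)) where

  flip-twice : ∀ x t → (E x → E (fold x σ (t * 2))) × (¬ E x → ¬ E (fold x σ (t * 2)))
  flip-twice x zero = (λ e → e) , (λ ¬e → ¬e)
  flip-twice x (suc t) =
    (λ e → false⇒true _ (true⇒false _ (proj₁ (flip-twice x t) e))) ,
    (λ ¬e → true⇒false _ (false⇒true _ (proj₂ (flip-twice x t) ¬e)))

  flipping-has-no-odd-period : ∀ x k → k % 2 ≡ 1 → fold x σ k ≡ x → ⊥
  flipping-has-no-odd-period x k k-odd period = ¬Ex (subst E back (false⇒true y (proj₂ (flip-twice x t) ¬Ex)))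
    where
    t : ℕ
    t = k / 2

    y : X
    y = fold x σ (t * 2)

    back : σ y ≡ x
    back = subst (λ m → fold x σ m ≡ x) (trans (m≡m%n+[m/n]*n k 2) (cong (_+ t * 2) k-odd)) period

    ¬Ex : ¬ E x
    ¬Ex e = true⇒false y (proj₁ (flip-twice x t) e) (subst E (sym back) e)

module OnCycle {n} (G : Graph n) {k} (C : EdgeSet n) (cycle : IsCycle G k C) where
  open Equivalence

  vertex : Fin k → Fin n
  vertex = proj₁ cycle

  3≤k : 3 ≤ k
  3≤k = proj₁ (proj₁ (proj₂ cycle))

  vertex-injective : ∀ {i j} → vertex i ≡ vertex j → i ≡ j
  vertex-injective = proj₁ (proj₂ (proj₁ (proj₂ cycle)))

  private
    consec-adjacent : ∀ i j → Consec k i j → _~_ G (vertex i) (vertex j)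
    consec-adjacent = proj₂ (proj₂ (proj₁ (proj₂ cycle)))

    edges : EdgeSetOf k vertex C
    edges = proj₂ (proj₂ cycle)

  consec-edge : ∀ {i j} → Consec k i j → C ∋ₑ vertex i , vertex j
  consec-edge {i} {j} c = from (edges _ _) (i , j , c , inj₁ (refl , refl))

  consec-edge′ : ∀ {i j} → Consec k i j → C ∋ₑ vertex j , vertex i
  consec-edge′ {i} {j} c = from (edges _ _) (i , j , c , inj₂ (refl , refl))

  edge-adjacent : ∀ {u v} → C ∋ₑ u , v → _~_ G u v
  edge-adjacent e with to (edges _ _) e
  ... | i , j , c , inj₁ (refl , refl) = consec-adjacent i j c
  ... | i , j , c , inj₂ (refl , refl) = Graph.sym G (consec-adjacent i j c)

  edge-sym : ∀ {u v} → C ∋ₑ u , v → C ∋ₑ v , u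
  edge-sym e with to (edges _ _) e
  ... | i , j , c , ends = from (edges _ _) (i , j , c , swap ends)

  edge-on-cycle : ∀ {u v} → C ∋ₑ u , v → Σ (Fin k) λ i → vertex i ≡ u
  edge-on-cycle e with to (edges _ _) e
  ... | i , j , c , inj₁ (i↦u , _) = i , i↦u
  ... | i , j , c , inj₂ (_ , j↦u) = j , j↦u

  neighbours : ∀ {i u} → C ∋ₑ vertex i , u → u ≡ vertex (pred i) ⊎ u ≡ vertex (succ i)
  neighbours {i} e with to (edges _ _) e
  ... | i′ , j′ , c , inj₁ (i′↦i , j′↦u) = inj₂ (trans (sym j′↦u) (cong vertex j′≡succ))
    where
    j′≡succ : j′ ≡ succ i
    j′≡succ = consec-functional (subst (λ h → Consec k h j′) (vertex-injective i′↦i) c) (succ-consec i)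
  ... | i′ , j′ , c , inj₂ (i′↦u , j′↦i) = inj₁ (trans (sym i′↦u) (cong vertex i′≡pred))
    where
    i′≡pred : i′ ≡ pred i
    i′≡pred = consec-injective (subst (Consec k i′) (vertex-injective j′↦i) c) (pred-consec i)

  pred≢succ : ∀ i → vertex (pred i) ≢ vertex (succ i)
  pred≢succ i p≡s =
    consec-asym 3≤k (succ-consec i) (subst (λ h → Consec k h i) (vertex-injective p≡s) (pred-consec i))

  other-neighbour : ∀ {v w} → C ∋ₑ v , w → Σ (Fin n) λ r → r ≢ w × C ∋ₑ v , r
  other-neighbour e with edge-on-cycle e
  ... | i , refl with neighbours e
  ... | inj₁ w≡p =
    vertex (succ i) , (λ s≡w → pred≢succ i (sym (trans s≡w w≡p))) , consec-edge (succ-consec i)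
  ... | inj₂ w≡s =
    vertex (pred i) , (λ p≡w → pred≢succ i (trans p≡w w≡s)) , consec-edge′ (pred-consec i)

  at-most-two : ∀ {v w₁ w₂ w₃} → C ∋ₑ v , w₁ → C ∋ₑ v , w₂ → C ∋ₑ v , w₃ →
                w₁ ≢ w₂ → w₁ ≢ w₃ → w₂ ≢ w₃ → ⊥
  at-most-two e₁ e₂ e₃ d₁₂ d₁₃ d₂₃ with edge-on-cycle e₁
  ... | i , refl with neighbours e₁ | neighbours e₂ | neighbours e₃
  ... | inj₁ p₁ | inj₁ p₂ | _       = d₁₂ (trans p₁ (sym p₂))
  ... | inj₂ s₁ | inj₂ s₂ | _       = d₁₂ (trans s₁ (sym s₂))
  ... | inj₁ p₁ | _       | inj₁ p₃ = d₁₃ (trans p₁ (sym p₃))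
  ... | inj₂ s₁ | _       | inj₂ s₃ = d₁₃ (trans s₁ (sym s₃))
  ... | _       | inj₁ p₂ | inj₁ p₃ = d₂₃ (trans p₂ (sym p₃))
  ... | _       | inj₂ s₂ | inj₂ s₃ = d₂₃ (trans s₂ (sym s₃))

module EdgeCounts {n} (G : Graph n) (g : ℕ) where
  open Equivalence

  ThroughImplies : Fin n → Fin n → Fin n → Fin n → Set
  ThroughImplies u v u′ v′ = ∀ C → IsCycle G g C → C ∋ₑ u , v → C ∋ₑ u′ , v′

  ε-mono : ∀ {u v u′ v′ m m′} → Epsilon G g u v m → Epsilon G g u′ v′ m′ →
           ThroughImplies u v u′ v′ → m ≤ m′
  ε-mono (L , uL , refl , memL) (L′ , uL′ , refl , memL′) through =
    unique-⊆⇒≤ uL uL′ λ {C} C∈L →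
      let (cyc , e) = to (memL C) C∈L in from (memL′ C) (cyc , through C cyc e)

  ε-strict : ∀ {u v u′ v′ m m′} → Epsilon G g u v m → Epsilon G g u′ v′ m′ →
             ThroughImplies u v u′ v′ →
             ∀ D → IsCycle G g D → D ∋ₑ u′ , v′ → ¬ D ∋ₑ u , v → m < m′
  ε-strict (L , uL , refl , memL) (L′ , uL′ , refl , memL′) through D cycD e′ ¬e =
    unique-⊂⇒< uL uL′
      (λ {C} C∈L → let (cyc , e) = to (memL C) C∈L in from (memL′ C) (cyc , through C cyc e))
      (from (memL′ D) (cycD , e′))
      (λ D∈L → ¬e (proj₂ (to (memL D) D∈L)))

  ε-sym : ∀ {u v m m′} → Epsilon G g u v m → Epsilon G g v u m′ → m ≡ m′
  ε-sym εuv εvu = ≤-antisym (ε-mono εuv εvu (λ C cyc → OnCycle.edge-sym G C cyc))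
                            (ε-mono εvu εuv (λ C cyc → OnCycle.edge-sym G C cyc))

  ε-one-exists : ∀ {u v} → Epsilon G g u v 1 → Σ (EdgeSet n) λ C → IsCycle G g C × C ∋ₑ u , v
  ε-one-exists (C ∷ [] , _ , _ , mem) = C , to (mem C) (here refl)
  ε-one-exists ([] , _ , () , _)
  ε-one-exists (_ ∷ _ ∷ _ , _ , () , _)

  ε-one-unique : ∀ {u v} → Epsilon G g u v 1 → ∀ C D →
                 IsCycle G g C → C ∋ₑ u , v → IsCycle G g D → D ∋ₑ u , v → C ≡ D
  ε-one-unique (E ∷ [] , _ , _ , mem) C D cycC eC cycD eD
    with from (mem C) (cycC , eC) | from (mem D) (cycD , eD)
  ... | here C≡E | here D≡E = trans C≡E (sym D≡E)
  ε-one-unique ([] , _ , () , _)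
  ε-one-unique (_ ∷ _ ∷ _ , _ , () , _)

module SignatureOne {n} (G : Graph n) (g a b c : ℕ)
                    (regular : GirthRegular G g a b c) (a≡1 : a ≡ 1) where
  open EdgeCounts G g

  record Frame (v : Fin n) : Set where
    field
      x y z      : Fin n
      adjacent-z : _~_ G v z
      x≢y        : x ≢ y
      x≢z        : x ≢ z
      y≢z        : y ≢ z
      neighbour  : ∀ w → _~_ G v w → w ≡ x ⊎ w ≡ y ⊎ w ≡ z
      εx         : Epsilon G g v x a
      εy         : Epsilon G g v y b
      εz         : Epsilon G g v z c

  frame : ∀ v → Frame v
  frame v with proj₂ regular v
  ... | x , y , z , (_ , _ , adj-z) , (x≢y , x≢z , y≢z) , nb , (εx , εy , εz) =
    record { x = x ; y = y ; z = z ; adjacent-z = adj-z ; x≢y = x≢y ; x≢z = x≢z ; y≢z = y≢z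
           ; neighbour = nb ; εx = εx ; εy = εy ; εz = εz }

  Z : Fin n → Fin n
  Z v = Frame.z (frame v)

  a≤b : a ≤ b
  a≤b = proj₁ (proj₁ regular)

  b≤c : b ≤ c
  b≤c = proj₂ (proj₁ regular)

  module AtVertex (v : Fin n) where
    open Frame (frame v)

    εx-one : Epsilon G g v x 1
    εx-one = subst (Epsilon G g v x) a≡1 εx

    second-neighbour : ∀ D {w} → IsCycle G g D → D ∋ₑ v , w →
                       Σ (Fin n) λ r → r ≢ w × D ∋ₑ v , r × (r ≡ x ⊎ r ≡ y ⊎ r ≡ z)
    second-neighbour D cyc e with OnCycle.other-neighbour G D cyc e
    ... | r , r≢w , e′ = r , r≢w , e′ , neighbour r (OnCycle.edge-adjacent G D cyc e′)

    -- No girth cycle passes through both vx and vy: otherwise every girth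
    -- cycle through vz would also pass through vy (it cannot use vx, whose only
    -- girth cycle avoids vz), giving c < b.
    no-cycle-through-x-and-y : ∀ C → IsCycle G g C → C ∋ₑ v , x → C ∋ₑ v , y → ⊥
    no-cycle-through-x-and-y C cycC cx cy =
      ≤⇒≯ b≤c (ε-strict εz εy through-z⇒through-y C cycC cy C∌vz)
      where
      C∌vz : ¬ C ∋ₑ v , z
      C∌vz cz = OnCycle.at-most-two G C cycC cx cy cz x≢y x≢z y≢z

      through-z⇒through-y : ThroughImplies v z v y
      through-z⇒through-y D cycD dz with second-neighbour D cycD dz
      ... | r , _ , dx , inj₁ refl =
        ⊥-elim (C∌vz (subst (_∋ₑ v , z) (ε-one-unique εx-one D C cycD dx cycC cx) dz))
      ... | r , _ , dy , inj₂ (inj₁ refl) = dy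
      ... | r , r≢z , _ , inj₂ (inj₂ r≡z) = ⊥-elim (r≢z r≡z)

    -- b < c: every girth cycle through vy passes through vz, and so does the
    -- girth cycle through vx, which avoids vy.
    b<c : b < c
    b<c with ε-one-exists εx-one
    ... | D , cycD , dx with second-neighbour D cycD dx
    ... | r , r≢x , _ , inj₁ r≡x = ⊥-elim (r≢x r≡x)
    ... | r , _ , dy , inj₂ (inj₁ refl) = ⊥-elim (no-cycle-through-x-and-y D cycD dx dy)
    ... | r , _ , dz , inj₂ (inj₂ refl) =
      ε-strict εy εz through-y⇒through-z D cycD dz (no-cycle-through-x-and-y D cycD dx)
      where
      through-y⇒through-z : ThroughImplies v y v z
      through-y⇒through-z E cycE ey with second-neighbour E cycE ey
      ... | r , _ , ex , inj₁ refl = ⊥-elim (no-cycle-through-x-and-y E cycE ex ey)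
      ... | r , r≢y , _ , inj₂ (inj₁ r≡y) = ⊥-elim (r≢y r≡y)
      ... | r , _ , ez , inj₂ (inj₂ refl) = ez

    cycle-uses-z : ∀ C {w w′} → IsCycle G g C → C ∋ₑ v , w → C ∋ₑ v , w′ → w ≢ w′ →
                   w ≡ z ⊎ w′ ≡ z
    cycle-uses-z C {w} {w′} cyc e e′ w≢w′
      with neighbour w (OnCycle.edge-adjacent G C cyc e)
         | neighbour w′ (OnCycle.edge-adjacent G C cyc e′)
    ... | inj₂ (inj₂ w≡z) | _                = inj₁ w≡z
    ... | _               | inj₂ (inj₂ w′≡z) = inj₂ w′≡z
    ... | inj₁ w≡x        | inj₁ w′≡x        = ⊥-elim (w≢w′ (trans w≡x (sym w′≡x)))
    ... | inj₂ (inj₁ w≡y) | inj₂ (inj₁ w′≡y) = ⊥-elim (w≢w′ (trans w≡y (sym w′≡y)))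
    ... | inj₁ refl       | inj₂ (inj₁ refl) = ⊥-elim (no-cycle-through-x-and-y C cyc e e′)
    ... | inj₂ (inj₁ refl) | inj₁ refl       = ⊥-elim (no-cycle-through-x-and-y C cyc e′ e)

  open AtVertex using (b<c; cycle-uses-z)

  count-at-Z : ∀ u {t m} → u ≡ t → Epsilon G g (Z u) t m → c ≡ m
  count-at-Z u refl = ε-sym (Frame.εz (frame u))

  -- Z is an involution: seen from Z(u), the edge to u has count c, and since
  -- a ≤ b < c this forces u = Z(Z(u)).
  Z-involution : ∀ u → Z (Z u) ≡ u
  Z-involution u with Frame.neighbour (frame (Z u)) u (Graph.sym G (Frame.adjacent-z (frame u)))
  ... | inj₁ u≡x = ⊥-elim (≤⇒≯ (≤-trans (≤-reflexive c≡a) a≤b) (b<c u))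
    where
    c≡a : c ≡ a
    c≡a = count-at-Z u u≡x (Frame.εx (frame (Z u)))
  ... | inj₂ (inj₁ u≡y) = ⊥-elim (<-irrefl (sym c≡b) (b<c u))
    where
    c≡b : c ≡ b
    c≡b = count-at-Z u u≡y (Frame.εy (frame (Z u)))
  ... | inj₂ (inj₂ u≡z) = sym u≡z

  -- By the involution property two
  -- Z-steps cannot follow each other, and since the cycle uses a matching edge
  -- at every vertex, two other steps cannot follow each other either.
  module AlongCycle (C : EdgeSet n) (cycle : IsCycle G g C) where
    open OnCycle G C cycle
    open ≡-Reasoning

    ZStep : Fin g → Set
    ZStep i = vertex (succ i) ≡ Z (vertex i)

    no-two-Z-steps : ∀ i → ZStep i → ¬ ZStep (succ i)
    no-two-Z-steps i step step′ =
      consec-asym 3≤k (succ-consec i) (subst (Consec g (succ i)) two-steps-back (succ-consec (succ i)))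
      where
      returns : vertex (succ (succ i)) ≡ vertex i
      returns = begin
        vertex (succ (succ i)) ≡⟨ step′ ⟩
        Z (vertex (succ i))    ≡⟨ cong Z step ⟩
        Z (Z (vertex i))       ≡⟨ Z-involution (vertex i) ⟩
        vertex i               ∎

      two-steps-back : succ (succ i) ≡ i
      two-steps-back = vertex-injective returns

    no-two-other-steps : ∀ i → ¬ ZStep i → ZStep (succ i)
    no-two-other-steps i ¬step
      with cycle-uses-z (vertex (succ i)) C cycle
             (consec-edge′ (pred-consec (succ i))) (consec-edge (succ-consec (succ i))) (pred≢succ (succ i))
    ... | inj₂ next≡Z = next≡Z
    ... | inj₁ prev≡Z = ⊥-elim (¬step (begin
        vertex (succ i)               ≡⟨ sym (Z-involution (vertex (succ i))) ⟩
        Z (Z (vertex (succ i)))       ≡⟨ cong Z (sym prev≡Z) ⟩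
        Z (vertex (pred (succ i)))    ≡⟨ cong (λ h → Z (vertex h)) (pred-succ i) ⟩
        Z (vertex i)                  ∎))

corollary3p3 : ∀ {n : ℕ} (G : Graph n) (g a b c : ℕ) →
    Cubic G → Girth G g → g % 2 ≡ 1 → GirthRegular G g a b c → a ≢ 1
corollary3p3 G zero a b c _ _ () _
corollary3p3 G (suc k) a b c _ ((C , cycle) , _) g-odd regular a≡1 =
  flipping-has-no-odd-period succ ZStep no-two-Z-steps no-two-other-steps fzero (suc k) g-odd (walk-period k)
  where
  open SignatureOne G (suc k) a b c regular a≡1
  open AlongCycle C cycle
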